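{- Suppose the nodes of an oriented ring run Algorithm 1 (described in the context) with IDs that are not necessarily unique; in particular, several nodes $v$ may have $\mathrm{ID}(v)=\mathrm{ID}_{\max}$. Then in any execution, at some point every node has sent and received exactly $\mathrm{ID}_{\max}$ pulses, and the network is in quiescence.
   Context: Oriented ring of $n$ nodes, content-oblivious asynchronous model (content-free pulses, delivered after arbitrary finite delays, never lost or injected; each node has an incoming queue per port). Each node $v$ has a positive integer ID $\mathrm{ID}(v)$ (not necessarily distinct); $\mathrm{ID}_{\max}=\max_v\mathrm{ID}(v)$. $\rho_{cw}(v)$ and $\sigma_{cw}(v)$ are the numbers of clockwise (CW) pulses node $v$ has received (consumed from its queue) and sent, initially 0. Algorithm 1 at node $v$: first send one CW pulse; then loop forever: if a CW pulse is waiting, consume it (incrementing $\rho_{cw}(v)$); then if $\rho_{cw}(v)=\mathrm{ID}(v)$ set state to Leader and send nothing, otherwise set state to Non-Leader and send one CW pulse. Quiescence: no pulses in transit (every sent pulse has been consumed). -}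

module Defs where

open import Data.Nat using (ℕ; zero; suc; _+_; _≤_; _⊔_; _≡ᵇ_)
open import Data.Nat.DivMod using (_%_; m%n<n)
open import Data.Bool using (Bool; true; false; if_then_else_)
open import Data.Fin using (Fin; toℕ; fromℕ<; _≟_)
open import Data.List using (foldr; map; allFin)
open import Data.Product using (_×_; ∃)
open import Relation.Binary.PropositionalEquality using (_≡_)
open import Relation.Nullary using (does)

cwNext : ∀ {m} → Fin (suc m) → Fin (suc m)
cwNext {m} i = fromℕ< (m%n<n (suc (toℕ i)) (suc m))

IDs : ℕ → Set
IDs m = Fin (suc m) → ℕ

IDmax : ∀ {m} → IDs m → ℕ
IDmax {m} ID = foldr _⊔_ 0 (map ID (allFin (suc m)))

data Status : Set where
  undecided leader nonLeader : Status

-- Local state of node v, together with the CW pulses heading to v: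
--   inTransit : CW pulses sent by v's CCW neighbour, not yet delivered to v's queue
--   queue     : CW pulses in v's incoming (CW) queue, not yet consumed
record Node : Set where
  constructor mkNode
  field
    started   : Bool     -- has v executed its initial "send one CW pulse"?
    ρcw       : ℕ        -- CW pulses received (consumed)
    σcw       : ℕ
    status    : Status
    inTransit : ℕ
    queue     : ℕ
open Node public

Config : ℕ → Set
Config m = Fin (suc m) → Node

initNode : Node
initNode = mkNode false 0 0 undecided 0 0

initConfig : ∀ {m} → Config m
initConfig _ = initNode

modify : ∀ {m} → Fin (suc m) → (Node → Node) → Config m → Config m
modify v f c w = if does (w ≟ v) then f (c w) else c w

sendCW : ∀ {m} → Fin (suc m) → Config m → Config m
sendCW v c =
  modify (cwNext v) (λ x → record x { inTransit = suc (inTransit x) })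
    (modify v (λ x → record x { σcw = suc (σcw x) }) c)

data Event (m : ℕ) : Set where
  act     : Fin (suc m) → Event m
  deliver : Fin (suc m) → Event m

actStep : ∀ {m} → IDs m → Fin (suc m) → Config m → Config m
actStep ID v c with started (c v) | queue (c v)
... | false | _ = sendCW v (modify v (λ x → record x { started = true }) c)
... | true | zero = c
... | true | suc q =
  let c₁ = modify v (λ x → record x { queue = q ; ρcw = suc (ρcw x) }) c in
  if suc (ρcw (c v)) ≡ᵇ ID v
    then modify v (λ x → record x { status = leader }) c₁
    else sendCW v (modify v (λ x → record x { status = nonLeader }) c₁)

deliverStep : ∀ {m} → Fin (suc m) → Config m → Config m
deliverStep v c with inTransit (c v)
... | zero = c
... | suc k = modify v (λ x → record x { inTransit = k ; queue = suc (queue x) }) c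

step : ∀ {m} → IDs m → Event m → Config m → Config m
step ID (act v) = actStep ID v
step ID (deliver v) = deliverStep v

Schedule : ℕ → Set
Schedule m = ℕ → Event m

-- Fairness: every node keeps running its loop forever, and every pulse is
-- delivered after a finite delay (each event kind recurs infinitely often).
Fair : ∀ {m} → Schedule m → Set
Fair {m} s = ∀ (e : Event m) (t : ℕ) → ∃ λ t' → t ≤ t' × s t' ≡ e

run : ∀ {m} → IDs m → Schedule m → ℕ → Config m
run ID s zero = initConfig
run ID s (suc t) = step ID (s t) (run ID s t)

Quiescent : ∀ {m} → Config m → Set
Quiescent {m} c = ∀ (v : Fin (suc m)) → inTransit (c v) ≡ 0 × queue (c v) ≡ 0

-- Three facts hold in every reachable configuration.  At each node the numbers
-- σ of sent and ρ of received pulses satisfy σ = ρ = 0 before it starts,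
-- σ = ρ + 1 while ρ < ID and σ = ρ afterwards (the ID-th pulse is swallowed).
-- The pulses sent by u are exactly those in transit to, queued at or consumed
-- by cwNext u.  No node has sent more than ID_max pulses, since it sends at most
-- max(ID, ρ) and ρ is bounded by what its predecessor sent.
-- The quantity σ + 2ρ + queue of a node grows with each of its enabled steps and
-- is bounded by 3·ID_max, so by fairness every execution reaches a configuration
-- in which all nodes have started and no pulse is queued or in transit.  There
-- σ(u) = ρ(cwNext u) ≤ σ(cwNext u), so σ is constant around the ring, hence so
-- is ρ; and σ = ρ forces every ID to be at most this common value, which is
-- therefore ID_max.

module Submission where

open import Defs
open import Data.Nat using (ℕ; zero; suc; _+_; _*_; _∸_; _≤_; _<_; _⊔_; _≡ᵇ_; z≤n; s≤s; z<s)
open import Data.Nat.Properties renaming (_≟_ to _≟ℕ_)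
open import Data.Nat.DivMod using (_%_; m<n⇒m%n≡m; n%n≡0)
open import Data.Nat.ListAction using (sum)
open import Data.Bool using (Bool; true; false; if_then_else_)
import Data.Bool.Properties as Bool
open import Data.Fin using (Fin; zero; suc; toℕ; fromℕ; inject₁; _≟_)
open import Data.Fin.Properties using (toℕ-fromℕ<; toℕ-fromℕ; toℕ-inject₁; toℕ<n; toℕ-injective; all?; ¬∀⟶∃¬)
open import Data.Fin.Relation.Unary.Top using (view; View; ‵fromℕ; ‵inj₁; ‵inject₁)
open import Data.List using (tabulate; allFin; map)
open import Data.List.Properties using (foldr-preservesᵇ; foldr-preservesᵒ)
import Data.List.Relation.Unary.All.Properties as All
import Data.List.Relation.Unary.Any.Properties as Any
open import Data.Product using (_×_; _,_; ∃; proj₁; proj₂; uncurry)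
open import Data.Sum using (_⊎_; inj₁; inj₂; [_,_]; map₂)
open import Data.Empty using (⊥-elim)
open import Function using (_∘_)
open import Relation.Nullary using (¬_; Dec; yes; no; does; proof; ofʸ; ofⁿ; contradiction)
open import Relation.Nullary.Decidable using (_×-dec_)
open import Relation.Binary.PropositionalEquality using (_≡_; _≢_; refl; sym; trans; cong; cong₂; subst; _≗_; module ≡-Reasoning)

private variable m : ℕ

sum-tabulate-mono : ∀ {n} {f g : Fin n → ℕ} → (∀ i → f i ≤ g i) → sum (tabulate f) ≤ sum (tabulate g)
sum-tabulate-mono {zero}  f≤g = z≤n
sum-tabulate-mono {suc n} f≤g = +-mono-≤ (f≤g zero) (sum-tabulate-mono (f≤g ∘ suc))

sum-tabulate-strict : ∀ {n} {f g : Fin n → ℕ} → (∀ i → f i ≤ g i) → ∀ j → f j < g j →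
                      sum (tabulate f) < sum (tabulate g)
sum-tabulate-strict f≤g zero    fj<gj = +-mono-<-≤ fj<gj (sum-tabulate-mono (f≤g ∘ suc))
sum-tabulate-strict f≤g (suc j) fj<gj = +-mono-≤-< (f≤g zero) (sum-tabulate-strict (f≤g ∘ suc) j fj<gj)

sum-tabulate-bounded : ∀ {n} {f : Fin n → ℕ} {b} → (∀ i → f i ≤ b) → sum (tabulate f) ≤ n * b
sum-tabulate-bounded {zero}  f≤b = z≤n
sum-tabulate-bounded {suc n} f≤b = +-mono-≤ (f≤b zero) (sum-tabulate-bounded (f≤b ∘ suc))

bounded-ascent : ∀ {p} (P : ℕ → Set p) (f : ℕ → ℕ) (b : ℕ) → (∀ t → f t ≤ b) →
                 (∀ t → P t ⊎ ∃ λ t′ → f t < f t′) → ∃ P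
bounded-ascent P f b f≤b ascend = go b 0 (m≤m+n b (f 0))
  where
  go : ∀ fuel t → b ≤ fuel + f t → ∃ P
  go fuel t b≤ with ascend t
  ... | inj₁ Pt = t , Pt
  ... | inj₂ (t′ , ft<ft′) with fuel
  ...   | zero      = contradiction (≤-<-trans b≤ ft<ft′) (≤⇒≯ (f≤b t′))
  ...   | suc fuel′ = go fuel′ t′ (≤-trans b≤ (≤-trans (≤-reflexive (sym (+-suc fuel′ (f t)))) (+-monoʳ-≤ fuel′ ft<ft′)))

-- The ring

cwNext-inject₁ : (i : Fin m) → cwNext (inject₁ i) ≡ suc i
cwNext-inject₁ {m} i = toℕ-injective (begin
  toℕ (cwNext (inject₁ i))      ≡⟨ toℕ-fromℕ< _ ⟩
  suc (toℕ (inject₁ i)) % suc m ≡⟨ cong (λ j → suc j % suc m) (toℕ-inject₁ i) ⟩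
  suc (toℕ i) % suc m           ≡⟨ m<n⇒m%n≡m (s≤s (toℕ<n i)) ⟩
  suc (toℕ i)                   ∎)
  where open ≡-Reasoning

cwNext-fromℕ : ∀ m → cwNext (fromℕ m) ≡ zero
cwNext-fromℕ m = toℕ-injective (begin
  toℕ (cwNext (fromℕ m))      ≡⟨ toℕ-fromℕ< _ ⟩
  suc (toℕ (fromℕ m)) % suc m ≡⟨ cong (λ j → suc j % suc m) (toℕ-fromℕ m) ⟩
  suc m % suc m               ≡⟨ n%n≡0 (suc m) ⟩
  0                           ∎)
  where open ≡-Reasoning

cwPrev : Fin (suc m) → Fin (suc m)
cwPrev zero    = fromℕ _
cwPrev (suc i) = inject₁ i

cwNext-cwPrev : (w : Fin (suc m)) → cwNext (cwPrev w) ≡ w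
cwNext-cwPrev zero    = cwNext-fromℕ _
cwNext-cwPrev (suc i) = cwNext-inject₁ i

cwPrev-cwNext : (w : Fin (suc m)) → cwPrev (cwNext w) ≡ w
cwPrev-cwNext w with view w
... | ‵fromℕ     = cong cwPrev (cwNext-fromℕ _)
... | ‵inject₁ i = cong cwPrev (cwNext-inject₁ i)

cwNext-injective : {u w : Fin (suc m)} → cwNext u ≡ cwNext w → u ≡ w
cwNext-injective {u = u} {w} eq = begin
  u                 ≡⟨ sym (cwPrev-cwNext u) ⟩
  cwPrev (cwNext u) ≡⟨ cong cwPrev eq ⟩
  cwPrev (cwNext w) ≡⟨ cwPrev-cwNext w ⟩
  w                 ∎
  where open ≡-Reasoning

Ascending : ∀ {n} → (Fin (suc n) → ℕ) → Set
Ascending g = ∀ i → g (inject₁ i) ≤ g (suc i)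

ascending-zero-≤ : ∀ {n} (g : Fin (suc n) → ℕ) → Ascending g → ∀ w → g zero ≤ g w
ascending-zero-≤ g asc zero            = ≤-refl
ascending-zero-≤ {suc n} g asc (suc w) = ≤-trans (asc zero) (ascending-zero-≤ (g ∘ suc) (asc ∘ suc) w)

ascending-≤-fromℕ : ∀ {n} (g : Fin (suc n) → ℕ) → Ascending g → ∀ w → g w ≤ g (fromℕ n)
ascending-≤-fromℕ g asc w = go g asc (view w)
  where
  go : ∀ {n} (g : Fin (suc n) → ℕ) → Ascending g → {w : Fin (suc n)} → View w → g w ≤ g (fromℕ n)
  go g asc ‵fromℕ            = ≤-refl
  go {suc n} g asc (‵inj₁ v) = ≤-trans (go (g ∘ inject₁) (asc ∘ inject₁) v) (asc (fromℕ n))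

ring-monotone⇒constant : (g : Fin (suc m) → ℕ) → (∀ u → g u ≤ g (cwNext u)) → ∀ w → g w ≡ g zero
ring-monotone⇒constant {m} g mono w = ≤-antisym
  (≤-trans (ascending-≤-fromℕ g asc w) (subst (λ z → g (fromℕ m) ≤ g z) (cwNext-fromℕ m) (mono (fromℕ m))))
  (ascending-zero-≤ g asc w)
  where
  asc : Ascending g
  asc i = subst (λ z → g (inject₁ i) ≤ g z) (cwNext-inject₁ i) (mono (inject₁ i))

ID≤IDmax : (ID : IDs m) → ∀ v → ID v ≤ IDmax ID
ID≤IDmax {m} ID v = foldr-preservesᵒ {P = ID v ≤_}
  (λ x y → [ m≤n⇒m≤n⊔o y , m≤n⇒m≤o⊔n x ])
  0 (map ID (allFin (suc m)))
  (inj₂ (Any.map⁺ (Any.tabulate⁺ {f = λ w → w} v ≤-refl)))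

IDmax-least : (ID : IDs m) → ∀ {k} → (∀ v → ID v ≤ k) → IDmax ID ≤ k
IDmax-least {m} ID {k} ID≤k = foldr-preservesᵇ {P = _≤ k} ⊔-lub z≤n (All.map⁺ (All.tabulate⁺ ID≤k))

data Tally (i : ℕ) : Bool → ℕ → ℕ → Set where
  unstarted : Tally i false 0 0
  relaying  : ∀ {ρ} → ρ < i → Tally i true ρ (suc ρ)
  swallowed : ∀ {ρ} → i ≤ ρ → Tally i true ρ ρ

module _ {i : ℕ} where

  tally-start : 0 < i → ∀ {ρ σ} → Tally i false ρ σ → Tally i true ρ (suc σ)
  tally-start 0<i unstarted = relaying 0<i

  tally-swallow : ∀ {ρ σ} → suc ρ ≡ i → Tally i true ρ σ → Tally i true (suc ρ) σ
  tally-swallow refl (relaying _)    = swallowed ≤-refl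
  tally-swallow refl (swallowed i≤ρ) = contradiction i≤ρ 1+n≰n

  tally-relay : ∀ {ρ σ} → suc ρ ≢ i → Tally i true ρ σ → Tally i true (suc ρ) (suc σ)
  tally-relay 1+ρ≢i (relaying ρ<i)  = relaying (≤∧≢⇒< ρ<i 1+ρ≢i)
  tally-relay _     (swallowed i≤ρ) = swallowed (m≤n⇒m≤1+n i≤ρ)

  tally-sent≤ : ∀ {s ρ σ} → Tally i s ρ σ → σ ≤ i ⊔ ρ
  tally-sent≤ unstarted      = z≤n
  tally-sent≤ (relaying ρ<i) = m≤n⇒m≤n⊔o _ ρ<i
  tally-sent≤ (swallowed _)  = m≤n⊔m i _

  tally-received≤sent : ∀ {ρ σ} → Tally i true ρ σ → ρ ≤ σ
  tally-received≤sent (relaying _)  = n≤1+n _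
  tally-received≤sent (swallowed _) = ≤-refl

  tally-balanced : ∀ {ρ σ} → Tally i true ρ σ → ρ ≡ σ → i ≤ ρ
  tally-balanced (swallowed i≤ρ) _ = i≤ρ

Consistent : ℕ → Node → Set
Consistent i x = Tally i (started x) (ρcw x) (σcw x)

emit : ℕ → Node → Node
emit k x = record x { inTransit = k + inTransit x }

inflow : Node → ℕ
inflow x = inTransit x + (queue x + ρcw x)

work : Node → ℕ
work x = σcw x + ρcw x + (queue x + ρcw x)

inflow-emit : ∀ k x → inflow (emit k x) ≡ k + inflow x
inflow-emit k x = +-assoc k (inTransit x) _

actNode : ℕ → Node → Node × ℕ
actNode i x with started x
... | false = record x { started = true ; σcw = suc (σcw x) } , 1
... | true with queue x
...   | zero  = x , 0
...   | suc q =
    if suc (ρcw x) ≡ᵇ i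
      then (record x { queue = q ; ρcw = suc (ρcw x) ; status = leader } , 0)
      else (record x { queue = q ; ρcw = suc (ρcw x) ; status = nonLeader ; σcw = suc (σcw x) } , 1)

deliverNode : Node → Node
deliverNode x with inTransit x
... | zero  = x
... | suc t = record x { inTransit = t ; queue = suc (queue x) }

-- The new state of the acting node and the number of pulses it sends.
react : Event m → ℕ → Node → Node × ℕ
react (act _)     i x = actNode i x
react (deliver _) i x = deliverNode x , 0

EnabledAt : Event m → Node → Set
EnabledAt (act _)     x = started x ≡ false ⊎ 0 < queue x
EnabledAt (deliver _) x = 0 < inTransit x

react-sent : (e : Event m) → ∀ i x → σcw (proj₁ (react e i x)) ≡ proj₂ (react e i x) + σcw x
react-sent (act _) i record { started = false }               = refl
react-sent (act _) i record { started = true ; queue = zero }  = refl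
react-sent (act _) i x@record { started = true ; queue = suc _ } with suc (ρcw x) ≡ᵇ i
... | true  = refl
... | false = refl
react-sent (deliver _) i record { inTransit = zero }  = refl
react-sent (deliver _) i record { inTransit = suc _ } = refl

react-inflow : (e : Event m) → ∀ i x → inflow (proj₁ (react e i x)) ≡ inflow x
react-inflow (act _) i record { started = false }               = refl
react-inflow (act _) i record { started = true ; queue = zero }  = refl
react-inflow (act _) i x@record { started = true ; queue = suc q } with suc (ρcw x) ≡ᵇ i
... | true  = cong (inTransit x +_) (+-suc q (ρcw x))
... | false = cong (inTransit x +_) (+-suc q (ρcw x))
react-inflow (deliver _) i record { inTransit = zero }  = refl
react-inflow (deliver _) i record { inTransit = suc t } = +-suc t _

react-consistent : (e : Event m) → ∀ {i} x → 0 < i → Consistent i x → Consistent i (proj₁ (react e i x))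
react-consistent (act _) record { started = false } 0<i               = tally-start 0<i
react-consistent (act _) record { started = true ; queue = zero } _   = λ tally → tally
react-consistent (act _) {i} x@record { started = true ; queue = suc _ } _
  with suc (ρcw x) ≡ᵇ i | proof (suc (ρcw x) ≟ℕ i)    -- does (m ≟ℕ n) is m ≡ᵇ n
... | true  | ofʸ 1+ρ≡i = tally-swallow 1+ρ≡i
... | false | ofⁿ 1+ρ≢i = tally-relay 1+ρ≢i
react-consistent (deliver _) record { inTransit = zero } _  = λ tally → tally
react-consistent (deliver _) record { inTransit = suc _ } _ = λ tally → tally

consume-increases-work : ∀ {σ σ′} ρ q → σ ≤ σ′ → σ + ρ + (suc q + ρ) < σ′ + suc ρ + (q + suc ρ)
consume-increases-work ρ q σ≤σ′ =
  +-mono-<-≤ (+-mono-≤-< σ≤σ′ (n<1+n ρ)) (≤-reflexive (sym (+-suc q ρ)))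

react-progress : (e : Event m) → ∀ i x →
                 (EnabledAt e x × work x < work (proj₁ (react e i x))) ⊎ (¬ EnabledAt e x × react e i x ≡ (x , 0))
react-progress (act _) i record { started = false }               = inj₁ (inj₁ refl , n<1+n _)
react-progress (act _) i record { started = true ; queue = zero }  = inj₂ ((λ { (inj₁ ()) ; (inj₂ ()) }) , refl)
react-progress (act _) i x@record { started = true ; queue = suc q } with suc (ρcw x) ≡ᵇ i
... | true  = inj₁ (inj₂ z<s , consume-increases-work (ρcw x) q ≤-refl)
... | false = inj₁ (inj₂ z<s , consume-increases-work (ρcw x) q (n≤1+n _))
react-progress (deliver _) i record { inTransit = zero }  = inj₂ ((λ ()) , refl)
react-progress (deliver _) i x@record { inTransit = suc _ } = inj₁ (z<s , +-monoʳ-< (σcw x + ρcw x) ≤-refl)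

module _ (v : Fin (suc m)) (f : Node → Node) (c : Config m) where

  modify-elim : ∀ {w} (P : Node → Set) → (w ≡ v → P (f (c w))) → (w ≢ v → P (c w)) → P (modify v f c w)
  modify-elim {w} P here there with w ≟ v
  ... | yes w≡v = here w≡v
  ... | no w≢v  = there w≢v

  modify-self : modify v f c v ≡ f (c v)
  modify-self = modify-elim (_≡ f (c v)) (λ _ → refl) (λ v≢v → ⊥-elim (v≢v refl))

  modify-other : ∀ {w} → w ≢ v → modify v f c w ≡ c w
  modify-other w≢v = modify-elim (_≡ _) (λ w≡v → ⊥-elim (w≢v w≡v)) (λ _ → refl)

  modify-const : modify v f c ≗ modify v (λ _ → f (c v)) c
  modify-const w with w ≟ v
  ... | yes refl = refl
  ... | no _     = refl

  modify-twice : ∀ g → modify v g (modify v f c) ≗ modify v (λ _ → g (f (c v))) c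
  modify-twice g w with w ≟ v
  ... | yes refl = refl
  ... | no _     = refl

modify-id : ∀ (v : Fin (suc m)) (c : Config m) → modify v (λ x → x) c ≗ c
modify-id v c w with does (w ≟ v)
... | true  = refl
... | false = refl

modify-cong : ∀ (v : Fin (suc m)) f {c c′ : Config m} → c ≗ c′ → modify v f c ≗ modify v f c′
modify-cong v f eq w = cong (λ x → if does (w ≟ v) then f x else x) (eq w)

node : Event m → Fin (suc m)
node (act v)     = v
node (deliver v) = v

localStep : Fin (suc m) → Node × ℕ → Config m → Config m
localStep v (y , k) c = modify (cwNext v) (emit k) (modify v (λ _ → y) c)

module _ (v : Fin (suc m)) (c : Config m) where

  localStep-silent : ∀ f → modify v f c ≗ localStep v (f (c v) , 0) c
  localStep-silent f w = trans (modify-const v f c w) (sym (modify-id (cwNext v) (modify v (λ _ → f (c v)) c) w))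

  localStep-idle : c ≗ localStep v (c v , 0) c
  localStep-idle w = trans (sym (modify-id v c w)) (localStep-silent (λ x → x) w)

  sendCW-localStep : ∀ f → sendCW v (modify v f c) ≗ localStep v (record (f (c v)) { σcw = suc (σcw (f (c v))) } , 1) c
  sendCW-localStep f = modify-cong (cwNext v) (emit 1) (modify-twice v f c (λ x → record x { σcw = suc (σcw x) }))

step-localStep : ∀ (ID : IDs m) e c → step ID e c ≗ localStep (node e) (react e (ID (node e)) (c (node e))) c
step-localStep ID (act v) c w with started (c v)
... | false = sendCW-localStep v c (λ x → record x { started = true }) w
... | true with queue (c v)
...   | zero  = localStep-idle v c w
...   | suc q with suc (ρcw (c v)) ≡ᵇ ID v
...     | true  = trans (modify-twice v consume c elect w) (localStep-silent v c (λ _ → elect (consume (c v))) w)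
          where
          consume = λ x → record x { queue = q ; ρcw = suc (ρcw x) }
          elect   = λ x → record x { status = leader }
...     | false = trans (modify-cong (cwNext v) (emit 1) (modify-cong v send (modify-twice v consume c relay)) w)
                        (sendCW-localStep v c (λ _ → relay (consume (c v))) w)
          where
          consume = λ x → record x { queue = q ; ρcw = suc (ρcw x) }
          relay   = λ x → record x { status = nonLeader }
          send    = λ x → record x { σcw = suc (σcw x) }
step-localStep ID (deliver v) c w with inTransit (c v)
... | zero  = localStep-idle v c w
... | suc t = localStep-silent v c (λ x → record x { inTransit = t ; queue = suc (queue x) }) w

Progress : Node → Node → Set
Progress x y = work x < work y ⊎ ∃ λ j → y ≡ emit j x

progress-emit : ∀ {x y} k → Progress x y → Progress x (emit k y)
progress-emit k (inj₁ lt)             = inj₁ lt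
progress-emit {x} k (inj₂ (j , refl)) = inj₂ (k + j , cong (λ n → record x { inTransit = n }) (sym (+-assoc k j _)))

enabledAt-emit : ∀ (e : Event m) {x} k → EnabledAt e x → EnabledAt e (emit k x)
enabledAt-emit (act _)     k enabled = enabled
enabledAt-emit (deliver _) k enabled = ≤-trans enabled (m≤n+m _ k)

module _ (v : Fin (suc m)) (y : Node) (k : ℕ) (c : Config m) where
  private
    c₁ = modify v (λ _ → y) c
    c₂ = localStep v (y , k) c

  localStep-preserves : (P : Fin (suc m) → Node → Set) → (∀ {w x} → P w x → P w (emit k x)) →
                        P v y → (∀ w → P w (c w)) → ∀ w → P w (c₂ w)
  localStep-preserves P P-emit Py Pc w =
    modify-elim (cwNext v) (emit k) c₁ (P w) (λ _ → P-emit P₁) (λ _ → P₁)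
    where
    P₁ : P w (c₁ w)
    P₁ = modify-elim v (λ _ → y) c (P w) (λ { refl → Py }) (λ _ → Pc w)

  localStep-observe : (g : Node → ℕ) → (∀ x → g (emit k x) ≡ g x) → ∀ w → g (c₂ w) ≡ g (c₁ w)
  localStep-observe g g-emit w =
    modify-elim (cwNext v) (emit k) c₁ (λ x → g x ≡ g (c₁ w)) (λ _ → g-emit (c₁ w)) (λ _ → refl)

  module _ (inflow-y : inflow y ≡ inflow (c v)) where

    private
      inflow₁ : ∀ w → inflow (c₁ w) ≡ inflow (c w)
      inflow₁ w = modify-elim v (λ _ → y) c (λ x → inflow x ≡ inflow (c w)) (λ { refl → inflow-y }) (λ _ → refl)

    localStep-inflow-target : inflow (c₂ (cwNext v)) ≡ k + inflow (c (cwNext v))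
    localStep-inflow-target = begin
      inflow (c₂ (cwNext v))          ≡⟨ cong inflow (modify-self (cwNext v) (emit k) c₁) ⟩
      inflow (emit k (c₁ (cwNext v))) ≡⟨ inflow-emit k (c₁ (cwNext v)) ⟩
      k + inflow (c₁ (cwNext v))      ≡⟨ cong (k +_) (inflow₁ (cwNext v)) ⟩
      k + inflow (c (cwNext v))       ∎
      where open ≡-Reasoning

    localStep-inflow-other : ∀ {w} → w ≢ cwNext v → inflow (c₂ w) ≡ inflow (c w)
    localStep-inflow-other {w} w≢ = trans (cong inflow (modify-other (cwNext v) (emit k) c₁ w≢)) (inflow₁ w)

-- Invariants

record Invariant (ID : IDs m) (c : Config m) : Set where
  field
    consistent  : ∀ w → Consistent (ID w) (c w)
    conserved   : ∀ u → inflow (c (cwNext u)) ≡ σcw (c u)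
    sent≤IDmax  : ∀ w → σcw (c w) ≤ IDmax ID
open Invariant

received≤inflow : ∀ x → ρcw x ≤ inflow x
received≤inflow x = ≤-trans (m≤n+m (ρcw x) (queue x)) (m≤n+m _ (inTransit x))

module _ {ID : IDs m} where

  inflow≤IDmax : ∀ {c} → Invariant ID c → ∀ w → inflow (c w) ≤ IDmax ID
  inflow≤IDmax {c} inv w = subst (λ u → inflow (c u) ≤ IDmax ID) (cwNext-cwPrev w)
    (≤-trans (≤-reflexive (conserved inv (cwPrev w))) (sent≤IDmax inv (cwPrev w)))

  invariant-≗ : ∀ {c c′} → c ≗ c′ → Invariant ID c → Invariant ID c′
  invariant-≗ {c} {c′} c≗c′ inv = record
    { consistent = λ w → subst (Consistent (ID w)) (c≗c′ w) (consistent inv w)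
    ; conserved  = λ u → trans (cong inflow (sym (c≗c′ (cwNext u)))) (trans (conserved inv u) (cong σcw (c≗c′ u)))
    ; sent≤IDmax = λ w → subst (λ x → σcw x ≤ IDmax ID) (c≗c′ w) (sent≤IDmax inv w)
    }

  initial-invariant : Invariant ID initConfig
  initial-invariant = record
    { consistent = λ _ → unstarted
    ; conserved  = λ _ → refl
    ; sent≤IDmax = λ _ → z≤n
    }

  localStep-invariant : ∀ {c v y k} → Invariant ID c → Consistent (ID v) y →
                        σcw y ≡ k + σcw (c v) → inflow y ≡ inflow (c v) → Invariant ID (localStep v (y , k) c)
  localStep-invariant {c} {v} {y} {k} inv consistent-y sent-y inflow-y = record
    { consistent = localStep-preserves v y k c (Consistent ∘ ID) (λ tally → tally) consistent-y (consistent inv)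
    ; conserved  = λ u → conserved-at u (u ≟ v)
    ; sent≤IDmax = localStep-preserves v y k c (λ _ x → σcw x ≤ IDmax ID) (λ σ≤ → σ≤) sent-y≤ (sent≤IDmax inv)
    }
    where
    c₁ = modify v (λ _ → y) c
    c₂ = localStep v (y , k) c

    sent-y≤ : σcw y ≤ IDmax ID
    sent-y≤ = ≤-trans (tally-sent≤ consistent-y)
      (⊔-lub (ID≤IDmax ID v) (≤-trans (received≤inflow y) (≤-trans (≤-reflexive inflow-y) (inflow≤IDmax inv v))))

    conserved-at : ∀ u → Dec (u ≡ v) → inflow (c₂ (cwNext u)) ≡ σcw (c₂ u)
    conserved-at u (yes refl) = begin
      inflow (c₂ (cwNext v))    ≡⟨ localStep-inflow-target v y k c inflow-y ⟩
      k + inflow (c (cwNext v)) ≡⟨ cong (k +_) (conserved inv v) ⟩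
      k + σcw (c v)             ≡⟨ sym sent-y ⟩
      σcw y                     ≡⟨ cong σcw (sym (modify-self v (λ _ → y) c)) ⟩
      σcw (c₁ v)                ≡⟨ sym (localStep-observe v y k c σcw (λ _ → refl) v) ⟩
      σcw (c₂ v)                ∎
      where open ≡-Reasoning
    conserved-at u (no u≢v) = begin
      inflow (c₂ (cwNext u))    ≡⟨ localStep-inflow-other v y k c inflow-y (u≢v ∘ cwNext-injective) ⟩
      inflow (c (cwNext u))     ≡⟨ conserved inv u ⟩
      σcw (c u)                 ≡⟨ cong σcw (sym (modify-other v (λ _ → y) c u≢v)) ⟩
      σcw (c₁ u)                ≡⟨ sym (localStep-observe v y k c σcw (λ _ → refl) u) ⟩
      σcw (c₂ u)                ∎
      where open ≡-Reasoning

Enabled : Event m → Config m → Set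
Enabled e c = EnabledAt e (c (node e))

module _ {ID : IDs m} (e : Event m) (c : Config m) where
  private
    v  = node e
    y  = proj₁ (react e (ID v) (c v))
    k  = proj₂ (react e (ID v) (c v))
    c₁ = modify v (λ _ → y) c

  step-invariant : (∀ w → 1 ≤ ID w) → Invariant ID c → Invariant ID (step ID e c)
  step-invariant ID-pos inv = invariant-≗ (sym ∘ step-localStep ID e c)
    (localStep-invariant inv (react-consistent e (c v) (ID-pos v) (consistent inv v))
                             (react-sent e (ID v) (c v)) (react-inflow e (ID v) (c v)))

  step-progress : ∀ w → Progress (c w) (step ID e c w)
  step-progress w = subst (Progress (c w)) (sym (step-localStep ID e c w))
    (localStep-preserves v y k c (Progress ∘ c) (progress-emit k) progress-y (λ w → inj₂ (0 , refl)) w)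
    where
    progress-y : Progress (c v) y
    progress-y with react-progress e (ID v) (c v)
    ... | inj₁ (_ , lt)   = inj₁ lt
    ... | inj₂ (_ , idle) = inj₂ (0 , cong proj₁ idle)

  step-fires : Enabled e c → work (c v) < work (step ID e c v)
  step-fires enabled with react-progress e (ID v) (c v)
  ... | inj₂ (disabled , _) = contradiction enabled disabled
  ... | inj₁ (_ , lt)       = subst (work (c v) <_) (sym work-after) lt
    where
    work-after : work (step ID e c v) ≡ work y
    work-after = begin
      work (step ID e c v)           ≡⟨ cong work (step-localStep ID e c v) ⟩
      work (localStep v (y , k) c v) ≡⟨ localStep-observe v y k c work (λ _ → refl) v ⟩
      work (c₁ v)                    ≡⟨ cong work (modify-self v (λ _ → y) c) ⟩
      work y                         ∎
      where open ≡-Reasoning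

-- Settled configurations

Idle : Node → Set
Idle x = started x ≡ true × inTransit x ≡ 0 × queue x ≡ 0

Settled : Config m → Set
Settled c = ∀ w → Idle (c w)

idle? : ∀ x → Dec (Idle x)
idle? x = (started x Bool.≟ true) ×-dec (inTransit x ≟ℕ 0) ×-dec (queue x ≟ℕ 0)

¬idle⇒enabled : ∀ (w : Fin (suc m)) x → ¬ Idle x → EnabledAt (act w) x ⊎ EnabledAt (deliver w) x
¬idle⇒enabled w record { started = false }                                   _     = inj₁ (inj₁ refl)
¬idle⇒enabled w record { started = true ; queue = suc _ }                    _     = inj₁ (inj₂ z<s)
¬idle⇒enabled w record { started = true ; queue = zero ; inTransit = suc _ } _     = inj₂ z<s
¬idle⇒enabled w record { started = true ; queue = zero ; inTransit = zero }  ¬idle = contradiction (refl , refl , refl) ¬idle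

enabled-at : (c : Config m) (w : Fin (suc m)) → ¬ Idle (c w) → ∃ λ e → Enabled e c
enabled-at c w ¬idle = [ (λ enabled → act w , enabled) , (λ enabled → deliver w , enabled) ] (¬idle⇒enabled w (c w) ¬idle)

settled-or-enabled : (c : Config m) → Settled c ⊎ ∃ λ e → Enabled e c
settled-or-enabled c with all? (idle? ∘ c)
... | yes settled = inj₁ settled
... | no ¬settled = inj₂ (uncurry (enabled-at c) (¬∀⟶∃¬ _ (Idle ∘ c) (idle? ∘ c) ¬settled))

settled⇒counts≡IDmax : ∀ {ID : IDs m} {c} → Invariant ID c → Settled c →
                       ∀ w → σcw (c w) ≡ IDmax ID × ρcw (c w) ≡ IDmax ID
settled⇒counts≡IDmax {ID = ID} {c} inv settled w = trans (sent≡K w) K≡IDmax , trans (received≡K w) K≡IDmax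
  where
  K = σcw (c zero)

  started-tally : ∀ w → Tally (ID w) true (ρcw (c w)) (σcw (c w))
  started-tally w = subst (λ b → Tally (ID w) b (ρcw (c w)) (σcw (c w))) (proj₁ (settled w)) (consistent inv w)

  inflow≡received : ∀ w → inflow (c w) ≡ ρcw (c w)
  inflow≡received w with settled w
  ... | _ , no-transit , no-queue = cong₂ (λ t q → t + (q + ρcw (c w))) no-transit no-queue

  sent≤next : ∀ u → σcw (c u) ≤ σcw (c (cwNext u))
  sent≤next u = ≤-trans (≤-reflexive (trans (sym (conserved inv u)) (inflow≡received (cwNext u))))
                        (tally-received≤sent (started-tally (cwNext u)))

  sent≡K : ∀ w → σcw (c w) ≡ K
  sent≡K = ring-monotone⇒constant (σcw ∘ c) sent≤next

  received≡K : ∀ w → ρcw (c w) ≡ K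
  received≡K w = begin
    ρcw (c w)                      ≡⟨ sym (inflow≡received w) ⟩
    inflow (c w)                   ≡⟨ cong (inflow ∘ c) (sym (cwNext-cwPrev w)) ⟩
    inflow (c (cwNext (cwPrev w))) ≡⟨ conserved inv (cwPrev w) ⟩
    σcw (c (cwPrev w))             ≡⟨ sent≡K (cwPrev w) ⟩
    K                              ∎
    where open ≡-Reasoning

  K≡IDmax : K ≡ IDmax ID
  K≡IDmax = ≤-antisym (sent≤IDmax inv zero) (IDmax-least ID λ w →
    subst (ID w ≤_) (received≡K w) (tally-balanced (started-tally w) (trans (received≡K w) (sym (sent≡K w)))))

-- Fair executions

module Execution (ID : IDs m) (ID-pos : ∀ v → 1 ≤ ID v) (s : Schedule m) (fair : Fair s) where

  config : ℕ → Config m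
  config = run ID s

  invariant : ∀ t → Invariant ID (config t)
  invariant zero    = initial-invariant
  invariant (suc t) = step-invariant (s t) (config t) ID-pos (invariant t)

  totalWork : ℕ → ℕ
  totalWork t = sum (tabulate (work ∘ config t))

  work-step : ∀ t w → work (config t w) ≤ work (config (suc t) w)
  work-step t w with step-progress (s t) (config t) w
  ... | inj₁ lt          = <⇒≤ lt
  ... | inj₂ (_ , after) = ≤-reflexive (cong work (sym after))

  totalWork-mono : ∀ t d → totalWork t ≤ totalWork (d + t)
  totalWork-mono t zero    = ≤-refl
  totalWork-mono t (suc d) = ≤-trans (totalWork-mono t d) (sum-tabulate-mono (work-step (d + t)))

  totalWork-bounded : ∀ t → totalWork t ≤ suc m * (IDmax ID + IDmax ID + IDmax ID)
  totalWork-bounded t = sum-tabulate-bounded λ w →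
    +-mono-≤ (+-mono-≤ (sent≤IDmax inv w) (≤-trans (received≤inflow (config t w)) (inflow≤IDmax inv w)))
             (≤-trans (m≤n+m _ (inTransit (config t w))) (inflow≤IDmax inv w))
    where inv = invariant t

  enabled-persists : ∀ e t d → Enabled e (config t) → totalWork t < totalWork (d + t) ⊎ Enabled e (config (d + t))
  enabled-persists e t zero    enabled = inj₂ enabled
  enabled-persists e t (suc d) enabled with enabled-persists e t d enabled
  ... | inj₁ lt = inj₁ (<-≤-trans lt (sum-tabulate-mono (work-step (d + t))))
  ... | inj₂ enabled′ with step-progress (s (d + t)) (config (d + t)) (node e)
  ...   | inj₁ lt          = inj₁ (≤-<-trans (totalWork-mono t d) (sum-tabulate-strict (work-step (d + t)) (node e) lt))
  ...   | inj₂ (j , after) = inj₂ (subst (EnabledAt e) (sym after) (enabledAt-emit e j enabled′))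

  scheduled-after : ∀ e t → ∃ λ d → s (d + t) ≡ e
  scheduled-after e t with fair e t
  ... | t′ , t≤t′ , scheduled = t′ ∸ t , subst (λ n → s n ≡ e) (sym (m∸n+n≡m t≤t′)) scheduled

  scheduled-fires : ∀ e t → s t ≡ e → Enabled e (config t) → totalWork t < totalWork (suc t)
  scheduled-fires e t refl enabled = sum-tabulate-strict (work-step t) (node e) (step-fires e (config t) enabled)

  work-eventually-increases : ∀ e t → Enabled e (config t) → ∃ λ t′ → totalWork t < totalWork t′
  work-eventually-increases e t enabled =
    [ (λ lt → d + t , lt)
    , (λ enabled′ → suc (d + t) , ≤-<-trans (totalWork-mono t d) (scheduled-fires e (d + t) scheduled enabled′))
    ] (enabled-persists e t d enabled)
    where
    d = proj₁ (scheduled-after e t)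
    scheduled = proj₂ (scheduled-after e t)

  ascent : ∀ t → Settled (config t) ⊎ ∃ λ t′ → totalWork t < totalWork t′
  ascent t = map₂ (uncurry λ e → work-eventually-increases e t) (settled-or-enabled (config t))

  settles : ∃ λ t → Settled (config t)
  settles = bounded-ascent _ totalWork _ totalWork-bounded ascent

lemma4p2 : (m : ℕ) (ID : IDs m) → (∀ v → 1 ≤ ID v) →
           (s : Schedule m) → Fair s →
           ∃ λ t → (∀ v → σcw (run ID s t v) ≡ IDmax ID × ρcw (run ID s t v) ≡ IDmax ID)
                   × Quiescent (run ID s t)
lemma4p2 m ID ID-pos s fair = t , settled⇒counts≡IDmax (invariant t) settled , proj₂ ∘ settled
  where
  open Execution ID ID-pos s fair
  t = proj₁ settles
  settled = proj₂ settles
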